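{- Let $\pi$ be a permutation of $[n]$ and $T\ge1$. For each round $t\in[T]$ let $m_t\ge1$, let $\tau_t:\{0,\dots,m_t-1\}\to\{\mathrm{Q},\mathrm{S}\}$ be the pile types of round $t$ with indicator $\chi_t(p)=[\tau_t(p)=\mathrm{S}]$, and let $\rho_t:[n]\to\{0,\dots,m_t-1\}$ be pile assignments. Define for $s\in[n]$: $\tilde\chi_{T+1}(s)=0$ and $\tilde\chi_t(s)=\big(\sum_{t'=t}^{T}\chi_{t'}(\rho_{t'}(s))\big)\bmod 2$; $\mathrm{rev}_m(y)=m-1-y$ with $\mathrm{rev}_m^0$ the identity; $\tilde\rho_t(s)=\mathrm{rev}_{m_t}^{\tilde\chi_{t+1}(s)}(\rho_t(s))$ for $t\in[T]$; $\hat\rho_T=\tilde\rho_T$ and $\hat\rho_t=\tilde\rho_t+m_t\hat\rho_{t+1}$ for $1\le t\le T-1$. Let $\hat M_t=\prod_{t'=t}^T m_{t'}$ and define $\hat\chi_t:\{0,\dots,\hat M_t-1\}\to\{0,1\}$ by $\hat\chi_T=\chi_T$ and, for $1\le t\le T-1$, $d\in\{0,\dots,m_t-1\}$, $v\in\{0,\dots,\hat M_{t+1}-1\}$: $$\hat\chi_t(d+m_tv)=\chi_t\big(\mathrm{rev}_{m_t}^{\hat\chi_{t+1}(v)}(d)\big)\oplus\hat\chi_{t+1}(v).$$ Let the virtual types be $\hat\tau_1(v)=\mathrm{S}$ if $\hat\chi_1(v)=1$ and $\mathrm{Q}$ otherwise, for $v\in\{0,\dots,\hat M_1-1\}$. Then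 the $T$-round heterogeneous shuffle of $\pi$ with types $(\tau_1,\dots,\tau_T)$ and pile assignments $(\rho_1,\dots,\rho_T)$ yields the same permutation as the single-round heterogeneous shuffle of $\pi$ with types $\hat\tau_1$ and pile assignments $\hat\rho_1$.
   Context: A deck of cards labelled by $[n]$ is represented by a permutation $\pi$ of $[n]$ with $\pi(s)$ the position (from the top) of label $s$. A single-round heterogeneous shuffle with pile assignments $\rho$ and types $\tau$ (label $s$ goes to pile $\rho(s)$; piles are collected in increasing order of index; a queue (Q) preserves placement order, a stack (S) reverses it) maps $\pi$ to the unique permutation $\sigma$ of $[n]$ with $\sigma(s)<\sigma(t)$ iff $\big(\rho(s),(-1)^{\chi(\rho(s))}\pi(s)\big)<\big(\rho(t),(-1)^{\chi(\rho(t))}\pi(t)\big)$ lexicographically, where $\chi(p)=[\tau(p)=\mathrm{S}]$. A $T$-round heterogeneous shuffle maps $\pi$ to $\pi_T$, where $\pi_0=\pi$ and $\pi_t$ is the single-round heterogeneous shuffle of $\pi_{t-1}$ with $(\tau_t,\rho_t)$. $a\oplus b=(a+b)\bmod 2$; $\mathrm{rev}_m^k$ is the $k$-fold composition of $\mathrm{rev}_m$; $[P]$ is the indicator of $P$. -}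

module Defs where

open import Data.Nat using (ℕ; zero; suc; _+_; _*_; _%_; _≡ᵇ_)
open import Data.Fin using (Fin; toℕ; opposite; combine; remQuot)
open import Data.Fin.Permutation using (Permutation′; _⟨$⟩ʳ_)
open import Data.Integer using (ℤ; +_; -[1+_]) renaming (_*_ to _*ℤ_; _^_ to _^ℤ_; _<_ to _<ℤ_)
open import Data.List using (List; []; _∷_)
open import Data.Product using (Σ; _×_; _,_)
open import Data.Sum using (_⊎_)
open import Data.Bool using (if_then_else_)
open import Function.Bundles using (_⇔_)
open import Relation.Binary.PropositionalEquality using (_≡_)
import Data.Nat as N
import Data.Fin as F

-- Pile types: queue or stack.
data PileType : Set where
  Q S : PileType

χ[_] : PileType → ℕ
χ[ Q ] = 0
χ[ S ] = 1

_⊕_ : ℕ → ℕ → ℕ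
a ⊕ b = (a + b) % 2

rev^ : ∀ {m} → ℕ → Fin m → Fin m
rev^ zero    y = y
rev^ (suc k) y = opposite (rev^ k y)

record Round (n : ℕ) : Set where
  constructor round
  field
    m : ℕ
    τ : Fin m → PileType
    ρ : Fin n → Fin m
open Round public

χρ : ∀ {n} → Round n → Fin n → ℕ
χρ r s = χ[ τ r (ρ r s) ]

LexLt : ℕ × ℤ → ℕ × ℤ → Set
LexLt (a , x) (b , y) = (a N.< b) ⊎ ((a ≡ b) × (x <ℤ y))

key : ∀ {n} → Permutation′ n → Round n → Fin n → ℕ × ℤ
key π r s = toℕ (ρ r s) , ((-[1+ 0 ] ^ℤ χρ r s) *ℤ (+ toℕ (π ⟨$⟩ʳ s)))

SingleShuffle : ∀ {n} → Permutation′ n → Round n → Permutation′ n → Set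
SingleShuffle {n} π r σ =
  (s t : Fin n) → ((σ ⟨$⟩ʳ s) F.< (σ ⟨$⟩ʳ t)) ⇔ LexLt (key π r s) (key π r t)

-- σ is the T-round heterogeneous shuffle of π with rounds r₁ ∷ [r₂,…,r_T].
MultiShuffle : ∀ {n} → Permutation′ n → Round n → List (Round n) → Permutation′ n → Set
MultiShuffle π r []        σ = SingleShuffle π r σ
MultiShuffle π r (r′ ∷ rs) σ = Σ (Permutation′ _) λ π₁ → SingleShuffle π r π₁ × MultiShuffle π₁ r′ rs σ

-- Σ_{t'=t}^{T} χ_{t'}(ρ_{t'}(s)) for the suffix of rounds (t,…,T); empty suffix = T+1.
sumχ : ∀ {n} → List (Round n) → Fin n → ℕ
sumχ []       s = 0
sumχ (r ∷ rs) s = χρ r s + sumχ rs s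

χ̃ : ∀ {n} → List (Round n) → Fin n → ℕ
χ̃ rs s = sumχ rs s % 2

-- ρ̃_t(s) = rev_{m_t}^{χ̃_{t+1}(s)}(ρ_t(s)), for round r = r_t followed by rest = (r_{t+1},…,r_T).
ρ̃ : ∀ {n} → (r : Round n) → List (Round n) → Fin n → Fin (m r)
ρ̃ r rest s = rev^ (χ̃ rest s) (ρ r s)

M̂ : ∀ {n} → Round n → List (Round n) → ℕ
M̂ r []        = m r
M̂ r (r′ ∷ rs) = M̂ r′ rs * m r

-- ρ̂_T = ρ̃_T ; ρ̂_t = ρ̃_t + m_t ρ̂_{t+1}  (combine v d has value v·m_t + d).
ρ̂ : ∀ {n} → (r : Round n) → (rs : List (Round n)) → Fin n → Fin (M̂ r rs)
ρ̂ r []          s = ρ̃ r [] s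
ρ̂ r (r′ ∷ rs) s = combine (ρ̂ r′ rs s) (ρ̃ r (r′ ∷ rs) s)

-- χ̂_T = χ_T ; χ̂_t(d + m_t v) = χ_t(rev_{m_t}^{χ̂_{t+1}(v)}(d)) ⊕ χ̂_{t+1}(v),
-- where x ↦ (v , d) is the inverse (remQuot) of (v , d) ↦ d + m_t v.
χ̂ : ∀ {n} → (r : Round n) → (rs : List (Round n)) → Fin (M̂ r rs) → ℕ
χ̂ r []        x = χ[ τ r x ]
χ̂ r (r′ ∷ rs) x with remQuot {M̂ r′ rs} (m r) x
... | v , d = χ[ τ r (rev^ (χ̂ r′ rs v) d) ] ⊕ χ̂ r′ rs v

τ̂ : ∀ {n} → (r : Round n) → (rs : List (Round n)) → Fin (M̂ r rs) → PileType
τ̂ r rs v = if χ̂ r rs v ≡ᵇ 1 then S else Q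

virtualRound : ∀ {n} → Round n → List (Round n) → Round n
virtualRound r rs = round (M̂ r rs) (τ̂ r rs) (ρ̂ r rs)

{-# OPTIONS --safe #-}
module Submission where

-- A round sorts the labels lexicographically by pile and then by previous position, upwards in a
-- queue and downwards in a stack.  Two rounds r then r′ therefore sort by the pile of r′ and,
-- inside each such pile, by the order r produces, reversed when that pile is a stack.  Reversing
-- the order of r is the same as reversing its pile indices and swapping queues and stacks, so r
-- followed by r′ is a single round r ⨾ r′ with m r′ · m r piles.  Folding the rounds from the
-- last one gives the virtual round; the type parity of the virtual pile of s is the parity χ̃ of
-- the stacks s meets.  Conversely, ranking shows that every strict total order of the labels is
-- the order of some deck, which supplies the intermediate decks.

open import Defs
open import Data.Nat using (_≤_)
open import Data.List using (List; _∷_)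
open import Data.List.Relation.Unary.All using (All)
open import Data.Fin.Permutation using (Permutation′)
open import Function.Bundles using (_⇔_)

open import Level using (Level)
open import Data.List using ([])
open import Data.Bool using (if_then_else_)
open import Data.Bool.Properties using (T-≡)
open import Data.Empty using (⊥-elim)
open import Data.Nat as ℕ using (ℕ; zero; suc; _+_; _%_; _≡ᵇ_; s<s)
import Data.Nat.Properties as ℕ
open import Data.Nat.DivMod using (m%n<n; m%n%n≡m%n; %-distribˡ-+)
open import Data.Fin as F using (Fin; toℕ; opposite; combine; remQuot; fromℕ<; punchOut)
import Data.Fin.Properties as F
open import Data.Fin.Permutation using (_⟨$⟩ʳ_; permutation)
open import Data.Fin.Subset using (Subset; ∣_∣; _∈_; _⊆_)
open import Data.Fin.Subset.Properties using (p⊂q⇒∣p∣<∣q∣; ∣⊤∣≡n; ⊆⊤; ∈⊤)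
open import Data.Integer using (ℤ; +_; -[1+_]) renaming (_*_ to _*ℤ_; _^_ to _^ℤ_; _<_ to _<ℤ_)
import Data.Integer as ℤ
import Data.Integer.Properties as ℤ
open import Data.Product using (_×_; _,_; proj₁; proj₂; ∃; <_,_>; uncurry)
import Data.Product as Prod
open import Data.Sum using (_⊎_; inj₁; inj₂; [_,_])
import Data.Sum as Sum
open import Data.Vec using (tabulate)
open import Data.Vec.Properties using (lookup∘tabulate; []=⇒lookup; lookup⇒[]=)
open import Function.Base using (_∘_; id; flip; const)
open import Function.Bundles using (mk⇔; Injection; module Equivalence)
open import Function.Definitions using (Injective)
open import Function.Properties.Inverse using (↔⇒↣)
import Function.Properties.Equivalence as ⇔
open import Relation.Binary.Core using (Rel)
open import Relation.Binary.Definitions using (Transitive; Trichotomous; tri<; tri≈; tri>)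
open import Relation.Binary.Consequences using (tri⇒dec<; tri⇒irr)
open import Relation.Binary.PropositionalEquality
  using (_≡_; _≢_; refl; sym; trans; cong; subst; subst₂; _≗_; module ≡-Reasoning)
import Relation.Binary.Reasoning.Setoid as SetoidReasoning
open import Relation.Nullary using (¬_; yes; no; contradiction)
open import Relation.Nullary.Decidable using (⌊_⌋; toWitness; fromWitness)

open Equivalence using (to; from)

private variable
  a ℓ ℓ′ ℓ″ : Level
  A B : Set a
  k k′ n : ℕ

infix 4 _≐_
_≐_ : Rel A ℓ → Rel A ℓ′ → Set _
R ≐ R′ = ∀ x y → R x y ⇔ R′ x y

≐-refl : {R : Rel A ℓ} → R ≐ R
≐-refl x y = ⇔.refl

≐-sym : {R : Rel A ℓ} {R′ : Rel A ℓ′} → R ≐ R′ → R′ ≐ R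
≐-sym R≐R′ x y = ⇔.sym (R≐R′ x y)

≐-trans : {R : Rel A ℓ} {R′ : Rel A ℓ′} {R″ : Rel A ℓ″} → R ≐ R′ → R′ ≐ R″ → R ≐ R″
≐-trans R≐R′ R′≐R″ x y = ⇔.trans (R≐R′ x y) (R′≐R″ x y)

≐-respʳ : {R : Rel A ℓ} {R₁ : Rel A ℓ′} {R₂ : Rel A ℓ″} → R₁ ≐ R₂ → (R ≐ R₁) ⇔ (R ≐ R₂)
≐-respʳ R₁≐R₂ = mk⇔ (flip ≐-trans R₁≐R₂) (flip ≐-trans (≐-sym R₁≐R₂))

trichotomous-on : (f : B → A) {R : Rel A ℓ} → Injective _≡_ _≡_ f →
                  Trichotomous _≡_ R → Trichotomous _≡_ (λ x y → R (f x) (f y))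
trichotomous-on f f-inj compare x y with compare (f x) (f y)
... | tri< r ¬e ¬r = tri< r (¬e ∘ cong f) ¬r
... | tri≈ ¬r e ¬r′ = tri≈ ¬r (f-inj e) ¬r′
... | tri> ¬r ¬e r = tri> ¬r (¬e ∘ cong f) r

opposite-reverses-< : {i j : Fin k} → i F.< j → opposite j F.< opposite i
opposite-reverses-< {i = i} {j} i<j = subst₂ ℕ._<_ (sym (F.opposite-prop j)) (sym (F.opposite-prop i))
  (ℕ.∸-monoʳ-< (s<s i<j) (F.toℕ<n j))

opposite-<-⇔ : {i j : Fin k} → opposite j F.< opposite i ⇔ i F.< j
opposite-<-⇔ {i = i} {j} = mk⇔
  (subst₂ F._<_ (F.opposite-involutive i) (F.opposite-involutive j) ∘ opposite-reverses-<)
  opposite-reverses-<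

opposite-injective : Injective _≡_ _≡_ (opposite {k})
opposite-injective {x = i} {j} e =
  trans (sym (F.opposite-involutive i)) (trans (cong opposite e) (F.opposite-involutive j))

combine-<-⇔ : (v : Fin k′) {i j : Fin k} → combine v i F.< combine v j ⇔ i F.< j
combine-<-⇔ {k′} {k} v {i} {j} rewrite F.toℕ-combine v i | F.toℕ-combine v j =
  mk⇔ (ℕ.+-cancelˡ-< (k ℕ.* toℕ v) (toℕ i) (toℕ j)) (ℕ.+-monoʳ-< (k ℕ.* toℕ v))

injective⇒onto : (f : Fin n → Fin n) → Injective _≡_ _≡_ f → ∀ y → ∃ λ x → f x ≡ y
injective⇒onto {suc n} f f-inj y with F.any? (λ x → f x F.≟ y)
... | yes hit = hit
... | no miss = contradiction (F.injective⇒≤ punchOut-inj) ℕ.1+n≰n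
  where
  y≢f : ∀ x → y ≢ f x
  y≢f x y≡fx = miss (x , sym y≡fx)
  punchOut-inj : Injective _≡_ _≡_ (λ x → punchOut (y≢f x))
  punchOut-inj {x} {x′} = f-inj ∘ F.punchOut-injective (y≢f x) (y≢f x′)

permutationOf : (f : Fin n → Fin n) → Injective _≡_ _≡_ f → Permutation′ n
permutationOf f f-inj = permutation f (proj₁ ∘ onto) (proj₂ ∘ onto) (λ x → f-inj (proj₂ (onto (f x))))
  where onto = injective⇒onto f f-inj

Before : Permutation′ n → Rel (Fin n) _
Before π s t = π ⟨$⟩ʳ s F.< π ⟨$⟩ʳ t

Before-transitive : (π : Permutation′ n) → Transitive (Before π)
Before-transitive π = F.<-trans

Before-trichotomous : (π : Permutation′ n) → Trichotomous _≡_ (Before π)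
Before-trichotomous π = trichotomous-on (π ⟨$⟩ʳ_) (Injection.injective (↔⇒↣ π)) F.<-cmp

module _ {R : Rel (Fin n) ℓ} (R-trans : Transitive R) (R-cmp : Trichotomous _≡_ R) where

  private
    below : Fin n → Subset n
    below t = tabulate (λ s → ⌊ tri⇒dec< R-cmp s t ⌋)

    ∈-below : ∀ {s t} → s ∈ below t ⇔ R s t
    ∈-below {s} {t} = mk⇔
      (λ s∈ → toWitness (from T-≡ (trans (sym (lookup∘tabulate _ s)) ([]=⇒lookup s∈))))
      (λ s<t → lookup⇒[]= s _ (trans (lookup∘tabulate _ s) (to T-≡ (fromWitness s<t))))

    R-irrefl : ∀ {t} → ¬ R t t
    R-irrefl = tri⇒irr R-cmp refl

    rank : Fin n → ℕ
    rank t = ∣ below t ∣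

    rank<n : ∀ t → rank t ℕ.< n
    rank<n t = subst (rank t ℕ.<_) (∣⊤∣≡n n) (p⊂q⇒∣p∣<∣q∣ (⊆⊤ , t , ∈⊤ , R-irrefl ∘ to ∈-below))

    rank-mono : ∀ {s t} → R s t → rank s ℕ.< rank t
    rank-mono {s} {t} s<t = p⊂q⇒∣p∣<∣q∣ (below-⊆ , s , from ∈-below s<t , R-irrefl ∘ to ∈-below)
      where
      below-⊆ : below s ⊆ below t
      below-⊆ u∈ = from ∈-below (R-trans (to ∈-below u∈) s<t)

    rank-<-⇔ : ∀ {s t} → rank s ℕ.< rank t ⇔ R s t
    rank-<-⇔ {s} {t} = mk⇔ reflect rank-mono
      where
      reflect : rank s ℕ.< rank t → R s t
      reflect rs<rt with R-cmp s t
      ... | tri< s<t _ _ = s<t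
      ... | tri≈ _ refl _ = contradiction rs<rt (ℕ.<-irrefl refl)
      ... | tri> _ _ t<s = contradiction (rank-mono t<s) (ℕ.<-asym rs<rt)

    position : Fin n → Fin n
    position t = fromℕ< (rank<n t)

    toℕ-position : ∀ t → toℕ (position t) ≡ rank t
    toℕ-position t = F.toℕ-fromℕ< (rank<n t)

    position-<-⇔ : ∀ {s t} → position s F.< position t ⇔ R s t
    position-<-⇔ {s} {t} = ⇔.trans (mk⇔ (subst₂ ℕ._<_ ps pt) (subst₂ ℕ._<_ (sym ps) (sym pt))) rank-<-⇔
      where
      ps = toℕ-position s
      pt = toℕ-position t

    position-injective : Injective _≡_ _≡_ position
    position-injective {s} {t} e with R-cmp s t
    ... | tri< s<t _ _ = contradiction e (F.<⇒≢ (from position-<-⇔ s<t))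
    ... | tri≈ _ s≡t _ = s≡t
    ... | tri> _ _ t<s = contradiction (sym e) (F.<⇒≢ (from position-<-⇔ t<s))

  Before-surjective : ∃ λ σ → Before σ ≐ R
  Before-surjective = permutationOf position position-injective , λ s t → position-<-⇔

flipType : PileType → PileType
flipType Q = S
flipType S = Q

infixl 7 _·_
_·_ : PileType → PileType → PileType
Q · q = q
S · q = flipType q

orient : PileType → Rel A ℓ → Rel A ℓ
orient Q R = R
orient S R = flip R

reorient : PileType → Fin k → Fin k
reorient Q = id
reorient S = opposite

orient-cong : ∀ p {R : Rel A ℓ} {R′ : Rel A ℓ′} → R ≐ R′ → orient p R ≐ orient p R′
orient-cong Q R≐R′ = R≐R′
orient-cong S R≐R′ x y = R≐R′ y x

orient-flipType : ∀ q {R : Rel A ℓ} → orient (flipType q) R ≐ flip (orient q R)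
orient-flipType Q = ≐-refl
orient-flipType S = ≐-refl

orient-transitive : ∀ p {R : Rel A ℓ} → Transitive R → Transitive (orient p R)
orient-transitive Q trans = trans
orient-transitive S trans = flip trans

orient-trichotomous : ∀ p {R : Rel A ℓ} → Trichotomous _≡_ R → Trichotomous _≡_ (orient p R)
orient-trichotomous Q compare = compare
orient-trichotomous S compare x y with compare y x
... | tri< r ¬e ¬r = tri< r (¬e ∘ sym) ¬r
... | tri≈ ¬r e ¬r′ = tri≈ ¬r (sym e) ¬r′
... | tri> ¬r ¬e r = tri> ¬r (¬e ∘ sym) r

PileLex : (Fin k → PileType) → Rel A ℓ → Rel (Fin k × A) ℓ
PileLex types R (i , x) (j , y) = i F.< j ⊎ (i ≡ j × orient (types i) R x y)

module _ {types : Fin k → PileType} {R : Rel A ℓ} where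

  PileLex-≡ : ∀ {i x y} → PileLex types R (i , x) (i , y) ⇔ orient (types i) R x y
  PileLex-≡ = mk⇔ [ ⊥-elim ∘ F.<-irrefl refl , proj₂ ] (inj₂ ∘ (refl ,_))

  PileLex-cong : {R′ : Rel A ℓ′} → R ≐ R′ → PileLex types R ≐ PileLex types R′
  PileLex-cong R≐R′ (i , x) (j , y) =
    mk⇔ (Sum.map₂ (Prod.map₂ (to (orient-cong (types i) R≐R′ x y))))
        (Sum.map₂ (Prod.map₂ (from (orient-cong (types i) R≐R′ x y))))

  PileLex-transitive : Transitive R → Transitive (PileLex types R)
  PileLex-transitive trans (inj₁ i<j) (inj₁ j<k) = inj₁ (F.<-trans i<j j<k)
  PileLex-transitive trans (inj₁ i<j) (inj₂ (refl , _)) = inj₁ i<j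
  PileLex-transitive trans (inj₂ (refl , _)) (inj₁ j<k) = inj₁ j<k
  PileLex-transitive trans {i , _} (inj₂ (refl , r)) (inj₂ (refl , r′)) =
    inj₂ (refl , orient-transitive (types i) trans r r′)

  PileLex-trichotomous : Trichotomous _≡_ R → Trichotomous _≡_ (PileLex types R)
  PileLex-trichotomous compare (i , x) (j , y) with F.<-cmp i j
  ... | tri< i<j i≢j i≯j = tri< (inj₁ i<j) (i≢j ∘ cong proj₁) [ i≯j , i≢j ∘ sym ∘ proj₁ ]
  ... | tri> i≮j i≢j i>j = tri> [ i≮j , i≢j ∘ proj₁ ] (i≢j ∘ cong proj₁) (inj₁ i>j)
  ... | tri≈ i≮i refl _ with orient-trichotomous (types i) compare x y
  ...   | tri< r ¬e ¬r = tri< (inj₂ (refl , r)) (¬e ∘ cong proj₂) [ i≮i , ¬r ∘ proj₂ ]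
  ...   | tri≈ ¬r e ¬r′ = tri≈ [ i≮i , ¬r ∘ proj₂ ] (cong (i ,_) e) [ i≮i , ¬r′ ∘ proj₂ ]
  ...   | tri> ¬r ¬e r = tri> [ i≮i , ¬r ∘ proj₂ ] (¬e ∘ cong proj₂) (inj₂ (refl , r))

  PileLex-opposite : ∀ {i j x y} → PileLex types R (j , y) (i , x) ⇔
                     PileLex (flipType ∘ types ∘ opposite) R (opposite i , x) (opposite j , y)
  PileLex-opposite {i} {j} {x} {y} = mk⇔ to′ from′
    where
    flipped : ∀ i → orient (types i) R y x ⇔ orient (flipType (types (opposite (opposite i)))) R x y
    flipped i rewrite F.opposite-involutive i = ⇔.sym (orient-flipType (types i) x y)
    to′ : _ → _
    to′ (inj₁ j<i) = inj₁ (opposite-reverses-< j<i)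
    to′ (inj₂ (refl , r)) = inj₂ (refl , to (flipped i) r)
    from′ : _ → _
    from′ (inj₁ i′<j′) = inj₁ (to opposite-<-⇔ i′<j′)
    from′ (inj₂ (e , r)) with refl ← opposite-injective e = inj₂ (refl , from (flipped i) r)

PileLex-cong-types : {types types′ : Fin k → PileType} {R : Rel A ℓ} →
                     types ≗ types′ → PileLex types R ≐ PileLex types′ R
PileLex-cong-types types≗ (i , x) (j , y) rewrite types≗ i = ⇔.refl

module _ {k′} {types : Fin (k′ ℕ.* k) → PileType} {R : Rel A ℓ} where

  PileLex-combine : ∀ (v : Fin k′) {i j x y} →
    PileLex types R (combine v i , x) (combine v j , y) ⇔ PileLex (types ∘ combine v) R (i , x) (j , y)
  PileLex-combine v {i} {j} = mk⇔
    (Sum.map (to (combine-<-⇔ v)) (Prod.map₁ (F.combine-injectiveʳ v i v j)))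
    (Sum.map (from (combine-<-⇔ v)) (Prod.map₁ (cong (combine v))))

ShuffleOrder : Round n → Rel (Fin n) ℓ → Rel (Fin n) ℓ
ShuffleOrder r R s t = PileLex (τ r) R (ρ r s , s) (ρ r t , t)

module _ (r : Round n) {R : Rel (Fin n) ℓ} where

  ShuffleOrder-cong : {R′ : Rel (Fin n) ℓ′} → R ≐ R′ → ShuffleOrder r R ≐ ShuffleOrder r R′
  ShuffleOrder-cong R≐R′ s t = PileLex-cong {types = τ r} R≐R′ (ρ r s , s) (ρ r t , t)

  ShuffleOrder-transitive : Transitive R → Transitive (ShuffleOrder r R)
  ShuffleOrder-transitive trans = PileLex-transitive {types = τ r} trans

  ShuffleOrder-trichotomous : Trichotomous _≡_ R → Trichotomous _≡_ (ShuffleOrder r R)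
  ShuffleOrder-trichotomous = trichotomous-on < ρ r , id > (cong proj₂) ∘ PileLex-trichotomous {types = τ r}

ShuffleOrder-cong-round : {types types′ : Fin k → PileType} {piles piles′ : Fin n → Fin k}
                          {R : Rel (Fin n) ℓ} → types ≗ types′ → piles ≗ piles′ →
  ShuffleOrder (round k types piles) R ≐ ShuffleOrder (round k types′ piles′) R
ShuffleOrder-cong-round {piles′ = piles′} types≗ piles≗ s t rewrite piles≗ s | piles≗ t =
  PileLex-cong-types types≗ (piles′ s , s) (piles′ t , t)

sign : PileType → ℤ
sign p = -[1+ 0 ] ^ℤ χ[ p ]

sign-< : ∀ p (f : A → Fin k) x y →
         (sign p *ℤ + toℕ (f x) <ℤ sign p *ℤ + toℕ (f y)) ⇔ orient p (λ x y → f x F.< f y) x y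
sign-< Q f x y rewrite ℤ.*-identityˡ (+ toℕ (f x)) | ℤ.*-identityˡ (+ toℕ (f y)) =
  mk⇔ ℤ.drop‿+<+ ℤ.+<+
sign-< S f x y rewrite ℤ.-1*i≡-i (+ toℕ (f x)) | ℤ.-1*i≡-i (+ toℕ (f y)) =
  mk⇔ (ℤ.drop‿+<+ ∘ ℤ.neg-cancel-<) (ℤ.neg-mono-< ∘ ℤ.+<+)

LexLt-key : (types : Fin k → PileType) (f : A → Fin k′) (i j : Fin k) (x y : A) →
  LexLt (toℕ i , sign (types i) *ℤ + toℕ (f x)) (toℕ j , sign (types j) *ℤ + toℕ (f y)) ⇔
  PileLex types (λ x y → f x F.< f y) (i , x) (j , y)
LexLt-key types f i j x y = mk⇔ to′ from′
  where
  to′ : _ → _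
  to′ (inj₁ i<j) = inj₁ i<j
  to′ (inj₂ (e , l)) with refl ← F.toℕ-injective e = inj₂ (refl , to (sign-< (types i) f x y) l)
  from′ : _ → _
  from′ (inj₁ i<j) = inj₁ i<j
  from′ (inj₂ (refl , o)) = inj₂ (refl , from (sign-< (types i) f x y) o)

module _ (π : Permutation′ n) (r : Round n) where

  key-ShuffleOrder : (λ s t → LexLt (key π r s) (key π r t)) ≐ ShuffleOrder r (Before π)
  key-ShuffleOrder s t = LexLt-key (τ r) (π ⟨$⟩ʳ_) (ρ r s) (ρ r t) s t

  singleShuffle⇔ : ∀ σ → SingleShuffle π r σ ⇔ (Before σ ≐ ShuffleOrder r (Before π))
  singleShuffle⇔ σ = ≐-respʳ key-ShuffleOrder

singleShuffle-exists : (π : Permutation′ n) (r : Round n) → ∃ (SingleShuffle π r)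
singleShuffle-exists π r =
  let σ , σ-realises = Before-surjective (ShuffleOrder-transitive r (Before-transitive π))
                                         (ShuffleOrder-trichotomous r (Before-trichotomous π))
  in σ , from (singleShuffle⇔ π r σ) σ-realises

reorientRound : PileType → Round n → Round n
reorientRound p r = round (m r) (λ i → p · τ r (reorient p i)) (reorient p ∘ ρ r)

orient-ShuffleOrder : ∀ p (r : Round n) {R : Rel (Fin n) ℓ} →
                      orient p (ShuffleOrder r R) ≐ ShuffleOrder (reorientRound p r) R
orient-ShuffleOrder Q r = ≐-refl
orient-ShuffleOrder S r s t = PileLex-opposite {types = τ r}

infixl 5 _⨾_
_⨾_ : Round n → Round n → Round n
_⨾_ {n} r r′ = round (m r′ ℕ.* m r) types piles
  where
  types : Fin (m r′ ℕ.* m r) → PileType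
  types = uncurry (λ v → τ (reorientRound (τ r′ v) r)) ∘ remQuot (m r)
  piles : Fin n → Fin (m r′ ℕ.* m r)
  piles s = combine (ρ r′ s) (ρ (reorientRound (τ r′ (ρ r′ s)) r) s)

τ-⨾-combine : (r r′ : Round n) (v : Fin (m r′)) →
              τ (r ⨾ r′) ∘ combine v ≗ τ (reorientRound (τ r′ v) r)
τ-⨾-combine r r′ v i = cong (uncurry (λ v → τ (reorientRound (τ r′ v) r))) (F.remQuot-combine v i)

ShuffleOrder-⨾ : (r r′ : Round n) {R : Rel (Fin n) ℓ} →
                 ShuffleOrder r′ (ShuffleOrder r R) ≐ ShuffleOrder (r ⨾ r′) R
ShuffleOrder-⨾ {n = n} r r′ {R} s t = piles (ρ r′ s) (ρ r′ t)
  where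
  inner : Fin (m r′) → Fin n → Fin (m r)
  inner v = ρ (reorientRound (τ r′ v) r)
  piles : ∀ v w → PileLex (τ r′) (ShuffleOrder r R) (v , s) (w , t) ⇔
                  PileLex (τ (r ⨾ r′)) R (combine v (inner v s) , s) (combine w (inner w t) , t)
  piles v w with F.<-cmp v w
  ... | tri< v<w _ _ = mk⇔ (const (inj₁ (F.combine-monoˡ-< _ _ v<w))) (const (inj₁ v<w))
  ... | tri> v≮w v≢w w<v = mk⇔ (⊥-elim ∘ [ v≮w , v≢w ∘ proj₁ ])
    (⊥-elim ∘ [ F.<-asym (F.combine-monoˡ-< _ _ w<v) , v≢w ∘ F.combine-injectiveˡ v _ w _ ∘ proj₁ ])
  ... | tri≈ _ refl _ = begin
    PileLex (τ r′) (ShuffleOrder r R) (v , s) (v , t)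
      ≈⟨ PileLex-≡ {types = τ r′} ⟩
    orient (τ r′ v) (ShuffleOrder r R) s t
      ≈⟨ orient-ShuffleOrder (τ r′ v) r s t ⟩
    ShuffleOrder (reorientRound (τ r′ v) r) R s t
      ≈⟨ PileLex-cong-types (sym ∘ τ-⨾-combine r r′ v) _ _ ⟩
    PileLex (τ (r ⨾ r′) ∘ combine v) R (inner v s , s) (inner v t , t)
      ≈⟨ ⇔.sym (PileLex-combine {types = τ (r ⨾ r′)} v) ⟩
    PileLex (τ (r ⨾ r′)) R (combine v (inner v s) , s) (combine v (inner v t) , t) ∎
    where open SetoidReasoning (⇔.⇔-setoid _)

toPileType : ℕ → PileType
toPileType b = if b ≡ᵇ 1 then S else Q

χ-toPileType-%2 : ∀ b → χ[ toPileType (b % 2) ] ≡ b % 2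
χ-toPileType-%2 b with b % 2 | m%n<n b 2
... | 0 | _ = refl
... | 1 | _ = refl
... | suc (suc _) | s<s (s<s ())

toPileType-⊕ : ∀ p q → toPileType (χ[ q ] ⊕ χ[ p ]) ≡ p · q
toPileType-⊕ Q Q = refl
toPileType-⊕ Q S = refl
toPileType-⊕ S Q = refl
toPileType-⊕ S S = refl

⊕-%2ʳ : ∀ b c → b ⊕ (c % 2) ≡ (b + c) % 2
⊕-%2ʳ b c = begin
  (b + c % 2) % 2         ≡⟨ %-distribˡ-+ b (c % 2) 2 ⟩
  (b % 2 + c % 2 % 2) % 2 ≡⟨ cong (λ c′ → (b % 2 + c′) % 2) (m%n%n≡m%n c 2) ⟩
  (b % 2 + c % 2) % 2     ≡⟨ %-distribˡ-+ b c 2 ⟨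
  (b + c) % 2             ∎
  where open ≡-Reasoning

rev^-χ : ∀ p (y : Fin k) → rev^ χ[ p ] y ≡ reorient p y
rev^-χ Q y = refl
rev^-χ S y = refl

rev^-opposite : ∀ j (y : Fin k) → rev^ j (opposite y) ≡ opposite (rev^ j y)
rev^-opposite zero    y = refl
rev^-opposite (suc j) y = cong opposite (rev^-opposite j y)

rev^-involutive : ∀ j (y : Fin k) → rev^ j (rev^ j y) ≡ y
rev^-involutive zero    y = refl
rev^-involutive (suc j) y = begin
  opposite (rev^ j (opposite (rev^ j y))) ≡⟨ cong opposite (rev^-opposite j (rev^ j y)) ⟩
  opposite (opposite (rev^ j (rev^ j y))) ≡⟨ F.opposite-involutive _ ⟩
  rev^ j (rev^ j y)                       ≡⟨ rev^-involutive j y ⟩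
  y                                       ∎
  where open ≡-Reasoning

module _ (r : Round n) where

  χ-τ̂ : ∀ rs x → χ[ τ̂ r rs x ] ≡ χ̂ r rs x
  χ-τ̂ []        x with τ r x
  ... | Q = refl
  ... | S = refl
  χ-τ̂ (r′ ∷ rs) x =
    let v , d = remQuot {M̂ r′ rs} (m r) x
    in  χ-toPileType-%2 (χ[ τ r (rev^ (χ̂ r′ rs v) d) ] + χ̂ r′ rs v)

  χ̂-combine : ∀ r′ rs (v : Fin (M̂ r′ rs)) d →
              χ̂ r (r′ ∷ rs) (combine v d) ≡ χ[ τ r (rev^ (χ̂ r′ rs v) d) ] ⊕ χ̂ r′ rs v
  χ̂-combine r′ rs v d =
    cong (uncurry λ v d → χ[ τ r (rev^ (χ̂ r′ rs v) d) ] ⊕ χ̂ r′ rs v) (F.remQuot-combine v d)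

  τ̂-[] : τ̂ r [] ≗ τ r
  τ̂-[] x with τ r x
  ... | Q = refl
  ... | S = refl

  ShuffleOrder-virtualRound-[] : {R : Rel (Fin n) ℓ} → ShuffleOrder (virtualRound r []) R ≐ ShuffleOrder r R
  ShuffleOrder-virtualRound-[] = ShuffleOrder-cong-round τ̂-[] (λ _ → refl)

χ̂-ρ̂ : (r : Round n) (rs : List (Round n)) (s : Fin n) → χ̂ r rs (ρ̂ r rs s) ≡ χ̃ (r ∷ rs) s
χ̂-ρ̂ r [] s with τ r (ρ r s)
... | Q = refl
... | S = refl
χ̂-ρ̂ r (r′ ∷ rs) s = begin
  χ̂ r (r′ ∷ rs) (combine (ρ̂ r′ rs s) (rev^ e (ρ r s)))
    ≡⟨ χ̂-combine r r′ rs _ _ ⟩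
  χ[ τ r (rev^ (χ̂ r′ rs (ρ̂ r′ rs s)) (rev^ e (ρ r s))) ] ⊕ χ̂ r′ rs (ρ̂ r′ rs s)
    ≡⟨ cong (λ c → χ[ τ r (rev^ c (rev^ e (ρ r s))) ] ⊕ c) (χ̂-ρ̂ r′ rs s) ⟩
  χ[ τ r (rev^ e (rev^ e (ρ r s))) ] ⊕ e
    ≡⟨ cong (λ y → χ[ τ r y ] ⊕ e) (rev^-involutive e (ρ r s)) ⟩
  χρ r s ⊕ (sumχ (r′ ∷ rs) s % 2)
    ≡⟨ ⊕-%2ʳ (χρ r s) (sumχ (r′ ∷ rs) s) ⟩
  χ̃ (r ∷ r′ ∷ rs) s ∎
  where
  open ≡-Reasoning
  e = χ̃ (r′ ∷ rs) s

module _ (r r′ : Round n) (rs : List (Round n)) where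

  ρ̂-∷ : ρ̂ r (r′ ∷ rs) ≗ ρ (r ⨾ virtualRound r′ rs)
  ρ̂-∷ s = cong (combine v) (begin
    rev^ (χ̃ (r′ ∷ rs) s) (ρ r s) ≡⟨ cong (λ c → rev^ c (ρ r s)) (sym (χ̂-ρ̂ r′ rs s)) ⟩
    rev^ (χ̂ r′ rs v) (ρ r s)     ≡⟨ cong (λ c → rev^ c (ρ r s)) (sym (χ-τ̂ r′ rs v)) ⟩
    rev^ χ[ τ̂ r′ rs v ] (ρ r s)  ≡⟨ rev^-χ (τ̂ r′ rs v) (ρ r s) ⟩
    reorient (τ̂ r′ rs v) (ρ r s) ∎)
    where
    open ≡-Reasoning
    v = ρ̂ r′ rs s

  τ̂-∷ : τ̂ r (r′ ∷ rs) ≗ τ (r ⨾ virtualRound r′ rs)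
  τ̂-∷ x = uncurry pile (remQuot {M̂ r′ rs} (m r) x)
    where
    pile : ∀ v d → toPileType (χ[ τ r (rev^ (χ̂ r′ rs v) d) ] ⊕ χ̂ r′ rs v) ≡
                   τ̂ r′ rs v · τ r (reorient (τ̂ r′ rs v) d)
    pile v d = begin
      toPileType (χ[ τ r (rev^ (χ̂ r′ rs v) d) ] ⊕ χ̂ r′ rs v)
        ≡⟨ cong (λ c → toPileType (χ[ τ r (rev^ c d) ] ⊕ c)) (sym (χ-τ̂ r′ rs v)) ⟩
      toPileType (χ[ τ r (rev^ χ[ p ] d) ] ⊕ χ[ p ])
        ≡⟨ cong (λ y → toPileType (χ[ τ r y ] ⊕ χ[ p ])) (rev^-χ p d) ⟩
      toPileType (χ[ τ r (reorient p d) ] ⊕ χ[ p ]) ≡⟨ toPileType-⊕ p _ ⟩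
      p · τ r (reorient p d)                         ∎
      where
      open ≡-Reasoning
      p = τ̂ r′ rs v

  ShuffleOrder-virtualRound-∷ : {R : Rel (Fin n) ℓ} →
    ShuffleOrder (virtualRound r (r′ ∷ rs)) R ≐ ShuffleOrder (r ⨾ virtualRound r′ rs) R
  ShuffleOrder-virtualRound-∷ = ShuffleOrder-cong-round τ̂-∷ ρ̂-∷

  ShuffleOrder-virtualRound-step : {R : Rel (Fin n) ℓ} {R₁ : Rel (Fin n) ℓ′} → R₁ ≐ ShuffleOrder r R →
    ShuffleOrder (virtualRound r′ rs) R₁ ≐ ShuffleOrder (virtualRound r (r′ ∷ rs)) R
  ShuffleOrder-virtualRound-step R₁≐ = ≐-trans (ShuffleOrder-cong (virtualRound r′ rs) R₁≐)
    (≐-trans (ShuffleOrder-⨾ r (virtualRound r′ rs)) (≐-sym ShuffleOrder-virtualRound-∷))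

multiShuffle⇔ : ∀ (π : Permutation′ n) r rs σ →
  MultiShuffle π r rs σ ⇔ (Before σ ≐ ShuffleOrder (virtualRound r rs) (Before π))
multiShuffle⇔ π r [] σ =
  ≐-respʳ (≐-trans (key-ShuffleOrder π r) (≐-sym (ShuffleOrder-virtualRound-[] r)))
multiShuffle⇔ π r (r′ ∷ rs) σ = mk⇔
  (λ (π₁ , first , rest) → ≐-trans (to (multiShuffle⇔ π₁ r′ rs σ) rest) (step π₁ first))
  (λ σ-realises → let π₁ , first = singleShuffle-exists π r in
    π₁ , first , from (multiShuffle⇔ π₁ r′ rs σ) (≐-trans σ-realises (≐-sym (step π₁ first))))
  where
  step : ∀ π₁ → SingleShuffle π r π₁ →
         ShuffleOrder (virtualRound r′ rs) (Before π₁) ≐ ShuffleOrder (virtualRound r (r′ ∷ rs)) (Before π)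
  step π₁ first = ShuffleOrder-virtualRound-step r r′ rs (to (singleShuffle⇔ π r π₁) first)

proposition2 : ∀ {n} (π : Permutation′ n) (r : Round n) (rs : List (Round n))
    → All (λ q → 1 ≤ m q) (r ∷ rs)
    → (σ : Permutation′ n)
    → MultiShuffle π r rs σ ⇔ SingleShuffle π (virtualRound r rs) σ
proposition2 π r rs _ σ =
  ⇔.trans (multiShuffle⇔ π r rs σ) (⇔.sym (singleShuffle⇔ π (virtualRound r rs) σ))
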